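{- Let $U$ and $V$ be two triangulations of a convex polygon $\pi$, and let $(a,b)$ and $(c,d)$ be two clockwise oriented boundary edges on $\pi$. If the edges $\{a,\mathrm{lk}_U(\{a,b\})\}$ and $\{c,\mathrm{lk}_U(\{c,d\})\}$ are distinct, and if they respectively cross the edges $\{d,\mathrm{lk}_V(\{c,d\})\}$ and $\{b,\mathrm{lk}_V(\{a,b\})\}$, then $\vartheta(\{U,V\},a)$ and $\vartheta(\{U,V\},c)$ cannot both be less than $2$.
   Context: An edge on a convex polygon is a set of two of its vertices; two edges cross if they are disjoint but their convex hulls intersect. A triangulation is an inclusion-maximal set of pairwise non-crossing edges. A flip replaces an interior edge $\varepsilon$ of a triangulation $T$ by the other diagonal of the unique quadrilateral having $\varepsilon$ as a diagonal and its four sides in $T$. A path from $U$ to $V$ is a sequence of triangulations starting at $U$, ending at $V$, consecutive ones differing by a flip; it is geodesic if its length (number of flips) is minimal. A clockwise oriented boundary edge $(a,b)$ is a pair of vertices with $b$ immediately following $a$ clockwise. For a triangulation $T$, $\mathrm{lk}_T(\{a,b\})$ is the unique vertex $x$ with $\{a,x\},\{b,x\}\in T$. A flip from $T$ to $T'$ is incident to $\{a,b\}$ if $\mathrm{lk}_T(\{a,b\})\neq\mathrm{lk}_{T'}(\{a,b\})$. For a vertex $a$ with clockwise successor $b$, $\vartheta(\{U,V\},a)$ is the maximum, over all geodesic paths between $U$ and $V$, of the number of flips incident to $\{a,b\}$ along the path. -}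

module Defs where

open import Data.Nat using (ℕ; zero; suc; _<_; _≤_; _+_)
open import Data.Nat.DivMod using (_%_; m%n<n)
open import Data.Fin using (Fin; toℕ; fromℕ<) renaming (_≟_ to _≟F_)
open import Data.Fin.Properties using ()
open import Data.Vec using (Vec; lookup)
open import Data.List using (List; findᵇ)
open import Data.List using () renaming (allFin to allFinL)
open import Data.Bool using (Bool; true; false; _∧_; _∨_; not)
open import Data.Maybe using (Maybe)
open import Data.Maybe.Properties using (≡-dec)
open import Data.Product using (Σ; _×_; _,_)
open import Data.Sum using (_⊎_)
open import Relation.Nullary using (¬_; does)
open import Relation.Binary.PropositionalEquality using (_≡_; _≢_)
open import Function.Bundles using (_⇔_)

-- Vertices of the convex polygon π with n vertices are Fin n, labelled
-- 0,1,…,n-1 in clockwise order.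

next : {k : ℕ} → Fin (suc k) → Fin (suc k)
next {k} i = fromℕ< (m%n<n (suc (toℕ i)) (suc k))

Between : {n : ℕ} → Fin n → Fin n → Fin n → Set
Between x a b = (toℕ a < toℕ x × toℕ x < toℕ b) ⊎ (toℕ b < toℕ x × toℕ x < toℕ a)

-- the edges {a,b} and {c,d} cross: they are disjoint and their convex hulls
-- intersect; for vertices in convex position this means exactly one of c,d
-- lies strictly on each side of the chord ab.
Cross : {n : ℕ} → Fin n → Fin n → Fin n → Fin n → Set
Cross a b c d =
  a ≢ c × a ≢ d × b ≢ c × b ≢ d × a ≢ b × c ≢ d ×
  ((Between c a b × ¬ Between d a b) ⊎ (Between d a b × ¬ Between c a b))

-- a set of edges: entry (i , j) with toℕ i < toℕ j encodes the edge {i,j}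
EdgeSet : ℕ → Set
EdgeSet n = Vec (Vec Bool n) n

entry : {n : ℕ} → EdgeSet n → Fin n → Fin n → Bool
entry T i j = lookup (lookup T i) j

has : {n : ℕ} → EdgeSet n → Fin n → Fin n → Bool
has T i j = entry T i j ∨ entry T j i

_∈E_ : {n : ℕ} → (Fin n × Fin n) → EdgeSet n → Set
(i , j) ∈E T = has T i j ≡ true

Canon : {n : ℕ} → EdgeSet n → Set
Canon {n} T = (i j : Fin n) → entry T i j ≡ true → toℕ i < toℕ j

SameE : {n : ℕ} → Fin n → Fin n → Fin n → Fin n → Set
SameE i j p r = (i ≡ p × j ≡ r) ⊎ (i ≡ r × j ≡ p)

NonCrossing : {n : ℕ} → EdgeSet n → Set
NonCrossing {n} T = (i j k l : Fin n) → (i , j) ∈E T → (k , l) ∈E T → ¬ Cross i j k l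

Maximal : {n : ℕ} → EdgeSet n → Set
Maximal {n} T = (i j : Fin n) → i ≢ j →
  ((k l : Fin n) → (k , l) ∈E T → ¬ Cross i j k l) → (i , j) ∈E T

IsTriangulation : {n : ℕ} → EdgeSet n → Set
IsTriangulation T = Canon T × NonCrossing T × Maximal T

Flip : {n : ℕ} → EdgeSet n → EdgeSet n → Set
Flip {n} T T' = Σ (Fin n) λ p → Σ (Fin n) λ q → Σ (Fin n) λ r → Σ (Fin n) λ s →
  (p , r) ∈E T × (p , q) ∈E T × (q , r) ∈E T × (r , s) ∈E T × (s , p) ∈E T ×
  Cross p r q s × Canon T' ×
  ((i j : Fin n) → ((i , j) ∈E T' ⇔ (((i , j) ∈E T × ¬ SameE i j p r) ⊎ SameE i j q s)))

data Path {n : ℕ} (U : EdgeSet n) : EdgeSet n → Set where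
  start : Path U U
  _▷_   : {T T' : EdgeSet n} → Path U T → Flip T T' → Path U T'

len : {n : ℕ} {U V : EdgeSet n} → Path U V → ℕ
len start = zero
len (P ▷ _) = suc (len P)

Geodesic : {n : ℕ} {U V : EdgeSet n} → Path U V → Set
Geodesic {n} {U} {V} P = (Q : Path U V) → len P ≤ len Q

-- lk_T({a,b}): the vertex x with {a,x},{b,x} ∈ T (found by search; for a
-- boundary edge of a triangulation it is unique)
lk : {n : ℕ} → EdgeSet n → Fin n → Fin n → Maybe (Fin n)
lk {n} T a b = findᵇ (λ x → has T a x ∧ has T b x) (allFinL n)

incident : {n : ℕ} → EdgeSet n → EdgeSet n → Fin n → Fin n → Bool
incident T T' a b = not (does (≡-dec _≟F_ (lk T a b) (lk T' a b)))

countInc : {n : ℕ} {U V : EdgeSet n} → Fin n → Fin n → Path U V → ℕ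
countInc a b start = zero
countInc a b (_▷_ {T} {T'} P _) with incident T T' a b
... | true  = suc (countInc a b P)
... | false = countInc a b P

IsTheta : {k : ℕ} → EdgeSet (suc k) → EdgeSet (suc k) → Fin (suc k) → ℕ → Set
IsTheta {k} U V a t =
  (Σ (Path U V) λ P → Geodesic P × countInc a (next a) P ≡ t) ×
  ((P : Path U V) → Geodesic P → countInc a (next a) P ≤ t)

-- Take a geodesic from U to V with at most one flip incident to each of
-- {a,b} and {c,d}.  Up to its flip incident to {a,b}, every triangulation
-- contains {a,x}, and from then on it contains {b,w}; likewise {c,y} and
-- {d,z}.  If the last flip incident to either boundary edge is incident to
-- {a,b} only, the triangulation before it contains the crossing edges {a,x}
-- and {d,z}; symmetrically for {c,d}.  If it is incident to both, the
-- triangulation before it contains {a,x} and {c,y}; a flip removes only one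
-- edge, so one of the two survives and crosses {d,z} or {b,w} afterwards.
-- (Without incident flips, U itself contains {a,x} and {d,z}.)  All this
-- contradicts that flips preserve non-crossing.
module Submission where

open import Defs
open import Data.Nat using (ℕ; suc; _<_)
open import Data.Fin using (Fin)
open import Data.Maybe using (just)
open import Data.Product using (_×_; _,_)
open import Relation.Nullary using (¬_)
open import Relation.Binary.PropositionalEquality using (_≡_)

open import Data.Bool using (true; false; _∧_; T)
open import Data.Bool.Properties using (T-≡; T-∧; T?; ∨-comm)
open import Data.Empty using (⊥; ⊥-elim)
open import Data.Fin using (toℕ) renaming (_≟_ to _≟F_)
open import Data.Fin.Properties using (toℕ-injective)
open import Data.List using (List; _∷_; find; allFin)
open import Data.Maybe.Properties using (≡-dec; just-injective)
open import Data.Nat using (_≤_; _<?_)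
open import Data.Nat.Properties using (<-trans; <-asym; <-cmp; ≤-pred; ≤-trans; n<1⇒n≡0)
open import Data.Product using (proj₁; proj₂)
open import Data.Sum using (_⊎_; inj₁; inj₂; [_,_]; swap)
open import Function using (_∘_)
open import Function.Bundles using (Equivalence)
open import Relation.Binary using (tri<; tri≈; tri>)
open import Relation.Binary.PropositionalEquality
  using (_≢_; refl; sym; trans; subst; ≢-sym)
open import Relation.Nullary using (Dec; yes; no)
open import Relation.Nullary.Decidable using (_×-dec_; _⊎-dec_)
open import Relation.Unary using (Decidable)

open Equivalence using (to; from)

find-sound : ∀ {A : Set} {P : A → Set} (P? : Decidable P) (xs : List A) {v : A} →
  find P? xs ≡ just v → P v
find-sound P? (x ∷ xs) eq with P? x
... | yes px = subst _ (just-injective eq) px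
... | no _   = find-sound P? xs eq

module _ {n : ℕ} (T′ : EdgeSet n) {a b v : Fin n} (lk≡v : lk T′ a b ≡ just v) where

  private
    link-edges : T (has T′ a v) × T (has T′ b v)
    link-edges = to T-∧ (find-sound (λ u → T? (has T′ a u ∧ has T′ b u)) (allFin n) lk≡v)

  lk-edgeˡ : (a , v) ∈E T′
  lk-edgeˡ = to T-≡ (proj₁ link-edges)

  lk-edgeʳ : (b , v) ∈E T′
  lk-edgeʳ = to T-≡ (proj₂ link-edges)

∈E-sym : ∀ {n} (T′ : EdgeSet n) {i j : Fin n} → (i , j) ∈E T′ → (j , i) ∈E T′
∈E-sym T′ {i} {j} ij = trans (∨-comm (entry T′ j i) (entry T′ i j)) ij

SameE-sym : ∀ {n} {i j k l : Fin n} → SameE i j k l → SameE k l i j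
SameE-sym (inj₁ (refl , refl)) = inj₁ (refl , refl)
SameE-sym (inj₂ (refl , refl)) = inj₂ (refl , refl)

SameE-trans : ∀ {n} {i j k l p r : Fin n} → SameE i j k l → SameE k l p r → SameE i j p r
SameE-trans (inj₁ (refl , refl)) s = s
SameE-trans (inj₂ (refl , refl)) (inj₁ (refl , refl)) = inj₂ (refl , refl)
SameE-trans (inj₂ (refl , refl)) (inj₂ (refl , refl)) = inj₁ (refl , refl)

SameE? : ∀ {n} (i j k l : Fin n) → Dec (SameE i j k l)
SameE? i j k l = ((i ≟F k) ×-dec (j ≟F l)) ⊎-dec ((i ≟F l) ×-dec (j ≟F k))

endpoint-off-edge : ∀ {n} {k l p r : Fin n} → p ≢ r → ¬ SameE k l p r →
  (p ≢ k × p ≢ l) ⊎ (r ≢ k × r ≢ l)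
endpoint-off-edge {k = k} {l} {p} {r} p≢r ¬kl≡pr with r ≟F k | r ≟F l
... | no r≢k   | no r≢l   = inj₂ (r≢k , r≢l)
... | yes refl | _        = inj₁ (p≢r , λ p≡l → ¬kl≡pr (inj₂ (refl , sym p≡l)))
... | no _     | yes refl = inj₁ ((λ p≡k → ¬kl≡pr (inj₁ (sym p≡k , refl))) , p≢r)

-- Between x a b unfolds to Betweenℕ (toℕ x) (toℕ a) (toℕ b).
Betweenℕ : ℕ → ℕ → ℕ → Set
Betweenℕ x a b = (a < x × x < b) ⊎ (b < x × x < a)

Betweenℕ-swap : ∀ {x a b} → Betweenℕ x a b → Betweenℕ x b a
Betweenℕ-swap (inj₁ p) = inj₂ p
Betweenℕ-swap (inj₂ p) = inj₁ p

Between? : ∀ {n} (v k l : Fin n) → Dec (Between v k l)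
Between? v k l = ((toℕ k <? toℕ v) ×-dec (toℕ v <? toℕ l))
          ⊎-dec ((toℕ l <? toℕ v) ×-dec (toℕ v <? toℕ k))

separation-sym-< : ∀ {a b c d} → a < c → c < b → d ≢ a → d ≢ b → ¬ Betweenℕ d a b →
  (Betweenℕ a c d × ¬ Betweenℕ b c d) ⊎ (Betweenℕ b c d × ¬ Betweenℕ a c d)
separation-sym-< {a} {b} {c} {d} a<c c<b d≢a d≢b d∉ab with <-cmp d a
... | tri< d<a _ _ = inj₁ (inj₂ (d<a , a<c) , λ
  { (inj₁ (_ , b<d)) → <-asym (<-trans d<a (<-trans a<c c<b)) b<d
  ; (inj₂ (_ , b<c)) → <-asym c<b b<c })
... | tri≈ _ d≡a _ = ⊥-elim (d≢a d≡a)
... | tri> _ _ a<d with <-cmp d b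
...   | tri< d<b _ _ = ⊥-elim (d∉ab (inj₁ (a<d , d<b)))
...   | tri≈ _ d≡b _ = ⊥-elim (d≢b d≡b)
...   | tri> _ _ b<d = inj₂ (inj₁ (c<b , b<d) , λ
  { (inj₁ (c<a , _)) → <-asym a<c c<a
  ; (inj₂ (d<a , _)) → <-asym a<d d<a })

separation-sym : ∀ {a b c d} → d ≢ a → d ≢ b → Betweenℕ c a b → ¬ Betweenℕ d a b →
  (Betweenℕ a c d × ¬ Betweenℕ b c d) ⊎ (Betweenℕ b c d × ¬ Betweenℕ a c d)
separation-sym d≢a d≢b (inj₁ (a<c , c<b)) d∉ab = separation-sym-< a<c c<b d≢a d≢b d∉ab
separation-sym d≢a d≢b (inj₂ (b<c , c<a)) d∉ab
  with separation-sym-< b<c c<a d≢b d≢a (d∉ab ∘ Betweenℕ-swap)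
... | inj₁ p = inj₂ p
... | inj₂ p = inj₁ p

Cross-sym : ∀ {n} {a b c d : Fin n} → Cross a b c d → Cross c d a b
Cross-sym (a≢c , a≢d , b≢c , b≢d , a≢b , c≢d , inj₁ (c∈ab , d∉ab)) =
  ≢-sym a≢c , ≢-sym b≢c , ≢-sym a≢d , ≢-sym b≢d , c≢d , a≢b ,
  separation-sym (≢-sym a≢d ∘ toℕ-injective) (≢-sym b≢d ∘ toℕ-injective) c∈ab d∉ab
Cross-sym (a≢c , a≢d , b≢c , b≢d , a≢b , c≢d , inj₂ (d∈ab , c∉ab)) =
  ≢-sym a≢c , ≢-sym b≢c , ≢-sym a≢d , ≢-sym b≢d , c≢d , a≢b ,
  swap-chord (separation-sym (≢-sym a≢c ∘ toℕ-injective) (≢-sym b≢c ∘ toℕ-injective) d∈ab c∉ab)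
  where
  swap-chord : ∀ {x y u v} →
    (Betweenℕ x u v × ¬ Betweenℕ y u v) ⊎ (Betweenℕ y u v × ¬ Betweenℕ x u v) →
    (Betweenℕ x v u × ¬ Betweenℕ y v u) ⊎ (Betweenℕ y v u × ¬ Betweenℕ x v u)
  swap-chord (inj₁ (i , o)) = inj₁ (Betweenℕ-swap i , o ∘ Betweenℕ-swap)
  swap-chord (inj₂ (i , o)) = inj₂ (Betweenℕ-swap i , o ∘ Betweenℕ-swap)

Cross-swapʳ : ∀ {n} {a b c d : Fin n} → Cross a b c d → Cross a b d c
Cross-swapʳ (a≢c , a≢d , b≢c , b≢d , a≢b , c≢d , sides) =
  a≢d , a≢c , b≢d , b≢c , a≢b , ≢-sym c≢d , swap sides

Cross-respʳ-SameE : ∀ {n} {i j k l u v : Fin n} → SameE k l u v → Cross i j k l → Cross i j u v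
Cross-respʳ-SameE (inj₁ (refl , refl)) X = X
Cross-respʳ-SameE (inj₂ (refl , refl)) X = Cross-swapʳ X

Cross-irrefl : ∀ {n} {i j k l : Fin n} → SameE i j k l → ¬ Cross i j k l
Cross-irrefl (inj₁ (refl , refl)) X = proj₁ X refl
Cross-irrefl (inj₂ (refl , refl)) X = proj₁ (proj₂ X) refl

Separated : ∀ {n} → Fin n → Fin n → Fin n → Fin n → Set
Separated k l x y = (Between x k l × ¬ Between y k l) ⊎ (Between y k l × ¬ Between x k l)

Cross-split : ∀ {n} {k l q s r : Fin n} → Cross k l q s →
  r ≢ k → r ≢ l → r ≢ q → r ≢ s → Cross k l q r ⊎ Cross k l r s
Cross-split {k = k} {l} {q} {s} {r} (k≢q , k≢s , l≢q , l≢s , k≢l , _ , sides) r≢k r≢l r≢q r≢s =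
  split (Between? r k l) sides
  where
  crosses-qr : Separated k l q r → Cross k l q r
  crosses-qr sep = k≢q , ≢-sym r≢k , l≢q , ≢-sym r≢l , k≢l , ≢-sym r≢q , sep

  crosses-rs : Separated k l r s → Cross k l r s
  crosses-rs sep = ≢-sym r≢k , k≢s , ≢-sym r≢l , l≢s , k≢l , r≢s , sep

  split : Dec (Between r k l) → Separated k l q s → Cross k l q r ⊎ Cross k l r s
  split (yes r∈) (inj₁ (_ , s∉)) = inj₂ (crosses-rs (inj₁ (r∈ , s∉)))
  split (no r∉)  (inj₁ (q∈ , _)) = inj₁ (crosses-qr (inj₁ (q∈ , r∉)))
  split (yes r∈) (inj₂ (_ , q∉)) = inj₁ (crosses-qr (inj₂ (r∈ , q∉)))
  split (no r∉)  (inj₂ (s∈ , _)) = inj₂ (crosses-rs (inj₂ (s∈ , r∉)))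

module _ {n : ℕ} (T′ : EdgeSet n) (nc : NonCrossing T′) where

  other-diagonal-crosses-only-diagonal : ∀ {p q r s} k l →
    (p , q) ∈E T′ → (q , r) ∈E T′ → (r , s) ∈E T′ → (s , p) ∈E T′ → Cross p r q s →
    (k , l) ∈E T′ → ¬ SameE k l p r → ¬ Cross k l q s
  other-diagonal-crosses-only-diagonal k l pq qr rs sp
    (p≢q , p≢s , r≢q , r≢s , p≢r , _) kl ¬kl≡pr X with endpoint-off-edge p≢r ¬kl≡pr
  ... | inj₁ (p≢k , p≢l) =
    [ nc _ _ _ _ kl (∈E-sym T′ pq) , nc _ _ _ _ kl (∈E-sym T′ sp) ] (Cross-split X p≢k p≢l p≢q p≢s)
  ... | inj₂ (r≢k , r≢l) =
    [ nc _ _ _ _ kl qr , nc _ _ _ _ kl rs ] (Cross-split X r≢k r≢l r≢q r≢s)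

flip-NonCrossing : ∀ {n} {T₀ T₁ : EdgeSet n} → NonCrossing T₀ → Flip T₀ T₁ → NonCrossing T₁
flip-NonCrossing {T₀ = T₀} nc (p , q , r , s , _ , pq , qr , rs , sp , Q , _ , T₁≡) i j k l ij kl X
  with to (T₁≡ i j) ij | to (T₁≡ k l) kl
... | inj₁ (ij₀ , _)      | inj₁ (kl₀ , _)      = nc i j k l ij₀ kl₀ X
... | inj₁ (ij₀ , ¬ij≡pr) | inj₂ kl≡qs          =
  other-diagonal-crosses-only-diagonal T₀ nc i j pq qr rs sp Q ij₀ ¬ij≡pr
    (Cross-respʳ-SameE kl≡qs X)
... | inj₂ ij≡qs          | inj₁ (kl₀ , ¬kl≡pr) =
  other-diagonal-crosses-only-diagonal T₀ nc k l pq qr rs sp Q kl₀ ¬kl≡pr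
    (Cross-respʳ-SameE ij≡qs (Cross-sym X))
... | inj₂ ij≡qs          | inj₂ kl≡qs          =
  Cross-irrefl (SameE-trans ij≡qs (SameE-sym kl≡qs)) X

path-NonCrossing : ∀ {n} {U T′ : EdgeSet n} → NonCrossing U → Path U T′ → NonCrossing T′
path-NonCrossing nc start   = nc
path-NonCrossing nc (_▷_ {T₀} {T₁} P f) =
  flip-NonCrossing {T₀ = T₀} {T₁} (path-NonCrossing nc P) f

flip-keeps-one-of : ∀ {n} {T₀ T₁ : EdgeSet n} {i j k l : Fin n} → Flip T₀ T₁ →
  (i , j) ∈E T₀ → (k , l) ∈E T₀ → ¬ SameE i j k l → (i , j) ∈E T₁ ⊎ (k , l) ∈E T₁
flip-keeps-one-of {i = i} {j} {k} {l} (p , q , r , s , _ , _ , _ , _ , _ , _ , _ , T₁≡) ij kl ¬ij≡kl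
  with SameE? i j p r | SameE? k l p r
... | no ¬ij≡pr  | _          = inj₁ (from (T₁≡ i j) (inj₁ (ij , ¬ij≡pr)))
... | yes _      | no ¬kl≡pr  = inj₂ (from (T₁≡ k l) (inj₁ (kl , ¬kl≡pr)))
... | yes ij≡pr  | yes kl≡pr  = ⊥-elim (¬ij≡kl (SameE-trans ij≡pr (SameE-sym kl≡pr)))

¬incident⇒lk-unchanged : ∀ {n} (T₀ T₁ : EdgeSet n) {a b : Fin n} →
  incident T₀ T₁ a b ≡ false → lk T₀ a b ≡ lk T₁ a b
¬incident⇒lk-unchanged T₀ T₁ {a} {b} ¬inc
  with ≡-dec _≟F_ (lk T₀ a b) (lk T₁ a b)
... | yes lk≡ = lk≡

no-incident-flips⇒lk-unchanged : ∀ {n} {U T′ : EdgeSet n} {a b : Fin n} (P : Path U T′) →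
  countInc a b P ≡ 0 → lk T′ a b ≡ lk U a b
no-incident-flips⇒lk-unchanged start _ = refl
no-incident-flips⇒lk-unchanged {a = a} {b} (_▷_ {T₀} {T₁} P _) count≡0
  with incident T₀ T₁ a b in ¬inc
... | false =
  trans (sym (¬incident⇒lk-unchanged T₀ T₁ ¬inc)) (no-incident-flips⇒lk-unchanged P count≡0)

lk-edge-survives : ∀ {n} {U T′ : EdgeSet n} {a b x : Fin n} (P : Path U T′) →
  countInc a b P ≡ 0 → lk U a b ≡ just x → (a , x) ∈E T′
lk-edge-survives {T′ = T′} P count≡0 lkU≡x =
  lk-edgeˡ T′ (trans (no-incident-flips⇒lk-unchanged P count≡0) lkU≡x)

module _ {n : ℕ} {U : EdgeSet n} (ncU : NonCrossing U) where

  lk-edges-do-not-cross : ∀ {T′} {a b c d x z : Fin n} (P : Path U T′) → countInc a b P ≡ 0 →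
    lk U a b ≡ just x → lk T′ c d ≡ just z → ¬ Cross a x d z
  lk-edges-do-not-cross {T′} P count≡0 lkU≡x lkT≡z =
    path-NonCrossing ncU P _ _ _ _ (lk-edge-survives P count≡0 lkU≡x) (lk-edgeʳ T′ lkT≡z)

  crossing-lk-edges⇒two-incident-flips : ∀ {T′} {a b c d x y z w : Fin n} (P : Path U T′) →
    lk U a b ≡ just x → lk U c d ≡ just y → lk T′ c d ≡ just z → lk T′ a b ≡ just w →
    ¬ SameE a x c y → Cross a x d z → Cross c y b w →
    countInc a b P ≤ 1 → countInc c d P ≤ 1 → ⊥
  crossing-lk-edges⇒two-incident-flips start lkU≡x _ lkT≡z _ _ X _ _ _ =
    lk-edges-do-not-cross start refl lkU≡x lkT≡z X
  crossing-lk-edges⇒two-incident-flips {a = a} {b} {c} {d} (_▷_ {T₀} {T₁} P f)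
    lkU≡x lkU≡y lkT≡z lkT≡w ¬ax≡cy X Y #ab≤1 #cd≤1
    with incident T₀ T₁ a b in inc-ab | incident T₀ T₁ c d in inc-cd
  ... | false | false =
    crossing-lk-edges⇒two-incident-flips P lkU≡x lkU≡y
      (trans (¬incident⇒lk-unchanged T₀ T₁ inc-cd) lkT≡z)
      (trans (¬incident⇒lk-unchanged T₀ T₁ inc-ab) lkT≡w)
      ¬ax≡cy X Y #ab≤1 #cd≤1
  ... | true | false =
    lk-edges-do-not-cross P (n<1⇒n≡0 #ab≤1) lkU≡x
      (trans (¬incident⇒lk-unchanged T₀ T₁ inc-cd) lkT≡z) X
  ... | false | true =
    lk-edges-do-not-cross P (n<1⇒n≡0 #cd≤1) lkU≡y
      (trans (¬incident⇒lk-unchanged T₀ T₁ inc-ab) lkT≡w) Y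
  ... | true | true
    with flip-keeps-one-of {T₀ = T₀} {T₁} f
           (lk-edge-survives P (n<1⇒n≡0 #ab≤1) lkU≡x)
           (lk-edge-survives P (n<1⇒n≡0 #cd≤1) lkU≡y) ¬ax≡cy
  ...   | inj₁ ax = path-NonCrossing {T′ = T₁} ncU (P ▷ f) _ _ _ _ ax (lk-edgeʳ T₁ lkT≡z) X
  ...   | inj₂ cy = path-NonCrossing {T′ = T₁} ncU (P ▷ f) _ _ _ _ cy (lk-edgeʳ T₁ lkT≡w) Y

theorem4 : (m : ℕ) → let n = suc (suc (suc m)) in
    (U V : EdgeSet n) → IsTriangulation U → IsTriangulation V →
    (a b c d : Fin n) → b ≡ next a → d ≡ next c →
    (x y z w : Fin n) →
    lk U a b ≡ just x → lk U c d ≡ just y →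
    lk V c d ≡ just z → lk V a b ≡ just w →
    ¬ SameE a x c y → Cross a x d z → Cross c y b w →
    (t₁ t₂ : ℕ) → IsTheta U V a t₁ → IsTheta U V c t₂ →
    ¬ (t₁ < 2 × t₂ < 2)
theorem4 m U V (_ , ncU , _) _ a .(next a) c .(next c) refl refl x y z w
  lkU≡x lkU≡y lkV≡z lkV≡w ¬ax≡cy X Y t₁ t₂ ((P , geodesic , #ab≡t₁) , _) (_ , #cd≤t₂)
  (t₁<2 , t₂<2) =
  crossing-lk-edges⇒two-incident-flips ncU P lkU≡x lkU≡y lkV≡z lkV≡w ¬ax≡cy X Y
    (subst (_≤ 1) (sym #ab≡t₁) (≤-pred t₁<2))
    (≤-trans (#cd≤t₂ P geodesic) (≤-pred t₂<2))
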